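{- Let $t:\mathcal{L}_{\Box}\to\mathcal{L}_{\triangleright}$ and $s:\mathcal{L}_{\triangleright}\to\mathcal{L}_{\Box}$ be the translations that fix atoms and $\bot$, commute with $\wedge,\vee,\to$, and satisfy $(\Box\phi)^t=\top\triangleright\phi^t$ and $(\theta\triangleright\psi)^s=\Box\psi^s$. Then: (i) if $\mathsf{EC}\vdash\phi$ then $\mathsf{CEC}\vdash\phi^t$; (ii) if $\mathsf{CEC}\vdash\psi$ then $\mathsf{EC}\vdash\psi^s$. The same two statements hold for the pair $\mathsf{ECN}$ and $\mathsf{CECN}$ in place of $\mathsf{EC}$ and $\mathsf{CEC}$.
   Context: $\mathcal{L}_{\Box}$: formulas from atoms and $\bot$ with $\wedge,\vee,\to$ and unary $\Box$; $\mathcal{L}_{\triangleright}$: same with binary $\triangleright$. $\top:=\bot\to\bot$. $\mathsf{E}$: smallest set of $\mathcal{L}_{\Box}$-formulas containing classical tautologies, closed under modus ponens and the rule from $\phi\leftrightarrow\psi$ infer $\Box\phi\leftrightarrow\Box\psi$; $\mathsf{EC}=\mathsf{E}+(C)$, (C) $\Box\phi\wedge\Box\psi\to\Box(\phi\wedge\psi)$; $\mathsf{ECN}=\mathsf{EC}+(N)$, (N) $\Box\top$. $\mathsf{CE}$: smallest set of $\mathcal{L}_{\triangleright}$-formulas containing classical tautologies, closed under modus ponens and the rule from $\phi_0\leftrightarrow\phi_1$ and $\psi_0\leftrightarrow\psi_1$ infer $(\phi_0\triangleright\psi_0)\to(\phi_1\triangleright\psi_1)$; $\mathsf{CEC}=\mathsf{CE}+(CC)$,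 (CC) $(\phi\triangleright\psi)\wedge(\phi\triangleright\theta)\to(\phi\triangleright\psi\wedge\theta)$; $\mathsf{CECN}=\mathsf{CEC}+(CN)$, (CN) $\phi\triangleright\top$. ($+$ means adding all instances of the scheme and closing under the rules.) -}

module Defs where

open import Data.Nat using (ℕ)
open import Data.Bool using (Bool; true; false; _∧_; _∨_; not)
open import Data.Product using (_×_; Σ; ∃-syntax)
open import Relation.Binary.PropositionalEquality using (_≡_)
open import Level using (0ℓ)

infixr 4 _↔B_ _↔C_
infixr 5 _→B_ _→C_
infixr 6 _∨B_ _∨C_
infixr 7 _∧B_ _∧C_
infix 8 _▷_
infix 9 □_

data FmB : Set where
  atB  : ℕ → FmB
  ⊥B   : FmB
  _∧B_ : FmB → FmB → FmB
  _∨B_ : FmB → FmB → FmB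
  _→B_ : FmB → FmB → FmB
  □_   : FmB → FmB

data FmC : Set where
  atC  : ℕ → FmC
  ⊥C   : FmC
  _∧C_ : FmC → FmC → FmC
  _∨C_ : FmC → FmC → FmC
  _→C_ : FmC → FmC → FmC
  _▷_  : FmC → FmC → FmC

⊤B : FmB
⊤B = ⊥B →B ⊥B

⊤C : FmC
⊤C = ⊥C →C ⊥C

_↔B_ : FmB → FmB → FmB
φ ↔B ψ = (φ →B ψ) ∧B (ψ →B φ)

_↔C_ : FmC → FmC → FmC
φ ↔C ψ = (φ →C ψ) ∧C (ψ →C φ)

_⇒b_ : Bool → Bool → Bool
a ⇒b b = not a ∨ b

-- Classical tautologies: true under every Boolean valuation, where atoms and
-- modal formulas (□φ, φ▷ψ) are treated as propositional variables.
evalB : (FmB → Bool) → FmB → Bool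
evalB v (atB n)  = v (atB n)
evalB v ⊥B       = false
evalB v (φ ∧B ψ) = evalB v φ ∧ evalB v ψ
evalB v (φ ∨B ψ) = evalB v φ ∨ evalB v ψ
evalB v (φ →B ψ) = evalB v φ ⇒b evalB v ψ
evalB v (□ φ)    = v (□ φ)

evalC : (FmC → Bool) → FmC → Bool
evalC v (atC n)  = v (atC n)
evalC v ⊥C       = false
evalC v (φ ∧C ψ) = evalC v φ ∧ evalC v ψ
evalC v (φ ∨C ψ) = evalC v φ ∨ evalC v ψ
evalC v (φ →C ψ) = evalC v φ ⇒b evalC v ψ
evalC v (φ ▷ ψ)  = v (φ ▷ ψ)

TautB : FmB → Set
TautB φ = (v : FmB → Bool) → evalB v φ ≡ true

TautC : FmC → Set
TautC φ = (v : FmC → Bool) → evalC v φ ≡ true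

data AxC : FmB → Set where
  inst : (φ ψ : FmB) → AxC ((□ φ ∧B □ ψ) →B □ (φ ∧B ψ))

data AxCN : FmB → Set where
  instC : (φ ψ : FmB) → AxCN ((□ φ ∧B □ ψ) →B □ (φ ∧B ψ))
  instN : AxCN (□ ⊤B)

data AxCC : FmC → Set where
  inst : (φ ψ θ : FmC) → AxCC (((φ ▷ ψ) ∧C (φ ▷ θ)) →C (φ ▷ (ψ ∧C θ)))

data AxCCN : FmC → Set where
  instCC : (φ ψ θ : FmC) → AxCCN (((φ ▷ ψ) ∧C (φ ▷ θ)) →C (φ ▷ (ψ ∧C θ)))
  instCN : (φ : FmC) → AxCCN (φ ▷ ⊤C)

data E+_⊢_ (Ax : FmB → Set) : FmB → Set where
  taut : ∀ {φ} → TautB φ → E+ Ax ⊢ φ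
  ax   : ∀ {φ} → Ax φ → E+ Ax ⊢ φ
  mp   : ∀ {φ ψ} → E+ Ax ⊢ (φ →B ψ) → E+ Ax ⊢ φ → E+ Ax ⊢ ψ
  re   : ∀ {φ ψ} → E+ Ax ⊢ (φ ↔B ψ) → E+ Ax ⊢ ((□ φ) ↔B (□ ψ))

data CE+_⊢_ (Ax : FmC → Set) : FmC → Set where
  taut : ∀ {φ} → TautC φ → CE+ Ax ⊢ φ
  ax   : ∀ {φ} → Ax φ → CE+ Ax ⊢ φ
  mp   : ∀ {φ ψ} → CE+ Ax ⊢ (φ →C ψ) → CE+ Ax ⊢ φ → CE+ Ax ⊢ ψ
  rce  : ∀ {φ₀ φ₁ ψ₀ ψ₁} → CE+ Ax ⊢ (φ₀ ↔C φ₁) → CE+ Ax ⊢ (ψ₀ ↔C ψ₁)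
       → CE+ Ax ⊢ ((φ₀ ▷ ψ₀) →C (φ₁ ▷ ψ₁))

EC⊢_ : FmB → Set
EC⊢ φ = E+ AxC ⊢ φ

ECN⊢_ : FmB → Set
ECN⊢ φ = E+ AxCN ⊢ φ

CEC⊢_ : FmC → Set
CEC⊢ φ = CE+ AxCC ⊢ φ

CECN⊢_ : FmC → Set
CECN⊢ φ = CE+ AxCCN ⊢ φ

t : FmB → FmC
t (atB n)  = atC n
t ⊥B       = ⊥C
t (φ ∧B ψ) = t φ ∧C t ψ
t (φ ∨B ψ) = t φ ∨C t ψ
t (φ →B ψ) = t φ →C t ψ
t (□ φ)    = ⊤C ▷ t φ

s : FmC → FmB
s (atC n)  = atB n
s ⊥C       = ⊥B
s (φ ∧C ψ) = s φ ∧B s ψ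
s (φ ∨C ψ) = s φ ∨B s ψ
s (φ →C ψ) = s φ →B s ψ
s (θ ▷ ψ)  = □ s ψ

-- Both translations commute with Boolean valuations, so they send tautologies
-- to tautologies. The rules correspond: RE for □φ = ⊤ ▷ φ is RCE applied in
-- both directions with ⊤ ↔ ⊤ on the left, and RCE is RE on the consequents
-- followed by one conjunct (s forgets the antecedent). Each axiom scheme is
-- mapped onto an instance of the matching scheme, so an induction on
-- derivations translates proofs in both directions.
module Submission where

open import Defs
open import Data.Bool using (Bool; true; false; _∧_; _∨_)
open import Data.Product using (_×_; _,_)
open import Function using (_∘_)
open import Relation.Binary.PropositionalEquality using (_≡_; refl; cong₂; trans; sym)

⇒b-refl : ∀ a → a ⇒b a ≡ true
⇒b-refl false = refl
⇒b-refl true  = refl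

⇒b-∧-intro : ∀ a b → a ⇒b (b ⇒b (a ∧ b)) ≡ true
⇒b-∧-intro false b     = refl
⇒b-∧-intro true  false = refl
⇒b-∧-intro true  true  = refl

⇒b-∧-elimˡ : ∀ a b → (a ∧ b) ⇒b a ≡ true
⇒b-∧-elimˡ false b     = refl
⇒b-∧-elimˡ true  false = refl
⇒b-∧-elimˡ true  true  = refl

⇒b-∧-comm : ∀ a b → (a ∧ b) ⇒b (b ∧ a) ≡ true
⇒b-∧-comm false false = refl
⇒b-∧-comm false true  = refl
⇒b-∧-comm true  false = refl
⇒b-∧-comm true  true  = refl

evalC-t : (v : FmC → Bool) (φ : FmB) → evalC v (t φ) ≡ evalB (evalC v ∘ t) φ
evalC-t v (atB n)  = refl
evalC-t v ⊥B       = refl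
evalC-t v (φ ∧B ψ) = cong₂ _∧_ (evalC-t v φ) (evalC-t v ψ)
evalC-t v (φ ∨B ψ) = cong₂ _∨_ (evalC-t v φ) (evalC-t v ψ)
evalC-t v (φ →B ψ) = cong₂ _⇒b_ (evalC-t v φ) (evalC-t v ψ)
evalC-t v (□ φ)    = refl

evalB-s : (v : FmB → Bool) (ψ : FmC) → evalB v (s ψ) ≡ evalC (evalB v ∘ s) ψ
evalB-s v (atC n)  = refl
evalB-s v ⊥C       = refl
evalB-s v (φ ∧C ψ) = cong₂ _∧_ (evalB-s v φ) (evalB-s v ψ)
evalB-s v (φ ∨C ψ) = cong₂ _∨_ (evalB-s v φ) (evalB-s v ψ)
evalB-s v (φ →C ψ) = cong₂ _⇒b_ (evalB-s v φ) (evalB-s v ψ)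
evalB-s v (θ ▷ ψ)  = refl

t-preserves-Taut : ∀ φ → TautB φ → TautC (t φ)
t-preserves-Taut φ taut-φ v = trans (evalC-t v φ) (taut-φ (evalC v ∘ t))

s-preserves-Taut : ∀ ψ → TautC ψ → TautB (s ψ)
s-preserves-Taut ψ taut-ψ v = trans (evalB-s v ψ) (taut-ψ (evalB v ∘ s))

module _ {Ax : FmC → Set} where

  ∧C-intro : ∀ {A B} → CE+ Ax ⊢ A → CE+ Ax ⊢ B → CE+ Ax ⊢ (A ∧C B)
  ∧C-intro {A} {B} ⊢A ⊢B =
    mp (mp (taut (λ v → ⇒b-∧-intro (evalC v A) (evalC v B))) ⊢A) ⊢B

  ↔C-refl : ∀ {A} → CE+ Ax ⊢ (A ↔C A)
  ↔C-refl {A} = ∧C-intro (taut (λ v → ⇒b-refl (evalC v A)))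
                          (taut (λ v → ⇒b-refl (evalC v A)))

  ↔C-sym : ∀ {A B} → CE+ Ax ⊢ (A ↔C B) → CE+ Ax ⊢ (B ↔C A)
  ↔C-sym {A} {B} = mp (taut (λ v → ⇒b-∧-comm (evalC v A ⇒b evalC v B)
                                              (evalC v B ⇒b evalC v A)))

  ▷-congʳ : ∀ {θ A B} → CE+ Ax ⊢ (A ↔C B) → CE+ Ax ⊢ ((θ ▷ A) ↔C (θ ▷ B))
  ▷-congʳ A↔B = ∧C-intro (rce ↔C-refl A↔B) (rce ↔C-refl (↔C-sym A↔B))

∧B-elimˡ : ∀ {Ax A B} → E+ Ax ⊢ (A ∧B B) → E+ Ax ⊢ A
∧B-elimˡ {A = A} {B} = mp (taut (λ v → ⇒b-∧-elimˡ (evalB v A) (evalB v B)))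

t-preserves-⊢ : ∀ {AxB AxC} → (∀ {φ} → AxB φ → CE+ AxC ⊢ t φ)
              → ∀ φ → E+ AxB ⊢ φ → CE+ AxC ⊢ t φ
t-preserves-⊢ t-ax φ (taut taut-φ) = taut (t-preserves-Taut φ taut-φ)
t-preserves-⊢ t-ax φ (ax ax-φ)     = t-ax ax-φ
t-preserves-⊢ t-ax φ (mp d e)      = mp (t-preserves-⊢ t-ax _ d) (t-preserves-⊢ t-ax _ e)
t-preserves-⊢ t-ax _ (re d)        = ▷-congʳ (t-preserves-⊢ t-ax _ d)

s-preserves-⊢ : ∀ {AxC AxB} → (∀ {ψ} → AxC ψ → E+ AxB ⊢ s ψ)
              → ∀ ψ → CE+ AxC ⊢ ψ → E+ AxB ⊢ s ψ
s-preserves-⊢ s-ax ψ (taut taut-ψ) = taut (s-preserves-Taut ψ taut-ψ)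
s-preserves-⊢ s-ax ψ (ax ax-ψ)     = s-ax ax-ψ
s-preserves-⊢ s-ax ψ (mp d e)      = mp (s-preserves-⊢ s-ax _ d) (s-preserves-⊢ s-ax _ e)
s-preserves-⊢ s-ax _ (rce _ e)     = ∧B-elimˡ (re (s-preserves-⊢ s-ax _ e))

t-AxC : ∀ {φ} → AxC φ → CEC⊢ t φ
t-AxC (inst φ ψ) = ax (inst ⊤C (t φ) (t ψ))

s-AxCC : ∀ {ψ} → AxCC ψ → EC⊢ s ψ
s-AxCC (inst φ ψ θ) = ax (inst (s ψ) (s θ))

t-AxCN : ∀ {φ} → AxCN φ → CECN⊢ t φ
t-AxCN (instC φ ψ) = ax (instCC ⊤C (t φ) (t ψ))
t-AxCN instN       = ax (instCN ⊤C)

s-AxCCN : ∀ {ψ} → AxCCN ψ → ECN⊢ s ψ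
s-AxCCN (instCC φ ψ θ) = ax (instC (s ψ) (s θ))
s-AxCCN (instCN φ)     = ax instN

mainTheorem7 : (((φ : FmB) → EC⊢ φ → CEC⊢ t φ) × ((ψ : FmC) → CEC⊢ ψ → EC⊢ s ψ))
    × (((φ : FmB) → ECN⊢ φ → CECN⊢ t φ) × ((ψ : FmC) → CECN⊢ ψ → ECN⊢ s ψ))
mainTheorem7 = (t-preserves-⊢ t-AxC  , s-preserves-⊢ s-AxCC)
             , (t-preserves-⊢ t-AxCN , s-preserves-⊢ s-AxCCN)
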